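{- There exist subsets $I_1, I_2, I_3 \subseteq [3]$, each of size $2$, such that with $\mathcal I = (I_1, I_2, I_3)$, $R_1 \mid S_1$ is an $\mathcal I$-substructure of $P_1 \mid Q_1$.
   Context: $C_6 = \{(0,0),(0,1),(1,0),(1,2),(2,1),(2,2)\}$, $C_6^*=C_6\setminus\{(0,0)\}$, $S_1 = C_6\times\{0,1,2\}\subseteq\{0,1,2\}^3$, $R_1 = (C_6^*\times\{0,1,2\})\cup(C_6\times\{1,2\})$. $P_1 = \{001,111,120,222,212\}\subseteq\{0,1,2\}^3$ and $Q_1 = P_1\cup\{000\}$. For $I\subseteq[r]$, $\pi_I x=(x_i:i\in I)$. For $P\subsetneq Q\subseteq D_1^{r_1}$, $R\subsetneq S\subseteq D_2^{r_2}$ and $\mathcal I=(I_1,\dots,I_{r_2})$ subsets of $[r_1]$, $P\mid Q$ is an $\mathcal I$-substructure of $R\mid S$ if there exist maps $g_j:D_1^{I_j}\to D_2$ with $(g_1(\pi_{I_1}x),\dots,g_{r_2}(\pi_{I_{r_2}}x))\in R$ for all $x\in P$ and $\in S\setminus R$ for all $x\in Q\setminus P$. -}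

module Defs where

open import Data.Nat using (ℕ)
open import Data.Fin using (Fin; zero; suc)
open import Data.Fin.Subset using (Subset; _∈_; ∣_∣)
open import Data.Bool using (Bool; true; false; _∧_; _∨_; not; T)
open import Data.Product using (Σ; _×_; _,_)
open import Data.List using (List; []; _∷_)
open import Data.Bool.ListAction using (any)
open import Relation.Nullary using (does)
import Data.Fin
open import Relation.Binary.PropositionalEquality using (_≡_)

D : Set
D = Fin 3

Rel : ℕ → Set
Rel r = (Fin r → D) → Bool

d0 d1 d2 : D
d0 = zero
d1 = suc zero
d2 = suc (suc zero)

_==_ : D → D → Bool
a == b = does (a Data.Fin.≟ b)

pairIs : D → D → D → D → Bool
pairIs a b a' b' = (a == a') ∧ (b == b')

inC6 : D → D → Bool
inC6 a b = any (λ p → pairIs a b (Data.Product.proj₁ p) (Data.Product.proj₂ p))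
  ((d0 , d0) ∷ (d0 , d1) ∷ (d1 , d0) ∷ (d1 , d2) ∷ (d2 , d1) ∷ (d2 , d2) ∷ [])

inC6* : D → D → Bool
inC6* a b = inC6 a b ∧ not (pairIs a b d0 d0)

i0 i1 i2 : Fin 3
i0 = zero
i1 = suc zero
i2 = suc (suc zero)

S₁ : Rel 3
S₁ x = inC6 (x i0) (x i1)

R₁ : Rel 3
R₁ x = inC6* (x i0) (x i1) ∨ (inC6 (x i0) (x i1) ∧ not (x i2 == d0))

tripleIs : (Fin 3 → D) → D → D → D → Bool
tripleIs x a b c = (x i0 == a) ∧ ((x i1 == b) ∧ (x i2 == c))

P₁ : Rel 3
P₁ x = tripleIs x d0 d0 d1 ∨ (tripleIs x d1 d1 d1 ∨ (tripleIs x d1 d2 d0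
       ∨ (tripleIs x d2 d2 d2 ∨ tripleIs x d2 d1 d2)))

Q₁ : Rel 3
Q₁ x = P₁ x ∨ tripleIs x d0 d0 d0

DPow : {r : ℕ} → Subset r → Set
DPow {r} I = Σ (Fin r) (λ i → i ∈ I) → D

π : {r : ℕ} (I : Subset r) → (Fin r → D) → DPow I
π I x (i , _) = x i

-- P | Q is an 𝓘-substructure of R | S  (P ⊊ Q ⊆ D^{r1}, R ⊊ S ⊆ D^{r2}),
-- 𝓘 = (I_1,…,I_{r2}) given as a function Fin r2 → Subset r1.
IsSubstructure : {r₁ r₂ : ℕ} → (𝓘 : Fin r₂ → Subset r₁) →
  Rel r₁ → Rel r₁ → Rel r₂ → Rel r₂ → Set
IsSubstructure {r₁} {r₂} 𝓘 P Q R S =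
  Σ ((j : Fin r₂) → DPow (𝓘 j) → D) λ g →
    ((x : Fin r₁ → D) → T (P x) → T (R (λ j → g j (π (𝓘 j) x))))
    × ((x : Fin r₁ → D) → T (Q x) → T (not (P x)) →
         T (S (λ j → g j (π (𝓘 j) x))) × T (not (R (λ j → g j (π (𝓘 j) x)))))

{-# OPTIONS --safe #-}
module Submission where

-- S₁ ∖ R₁ and Q₁ ∖ P₁ are both the single triple 000, so it suffices to find binary
-- maps g₀ g₁ g₂ vanishing at (0 , 0) such that (g₀ a b , g₁ a c , g₂ b c) ∈ P₁ for all
-- (a , b , c) ∈ R₁. The pair (a , b) ∈ C₆ essentially determines the image: (0,0) and
-- (0,1) go to 001, (1,0) to 111 or 120, (1,2) to 222 or 212, (2,1) to 111 and (2,2) to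
-- 212; besides separating 000 from 001, the coordinate c only matters when a = 1.

open import Defs
open import Data.Bool using (T; not)
open import Data.Fin using (Fin; zero; suc; opposite)
open import Data.Fin.Properties using (all?)
open import Data.Fin.Subset using (Subset; ∣_∣; ∁; ⁅_⁆)
open import Data.Fin.Subset.Properties using (∣∁p∣≡n∸∣p∣; ∣⁅x⁆∣≡1)
open import Data.Nat using (ℕ; _∸_)
open import Data.Product using (Σ; _×_; _,_)
open import Data.Unit using (tt)
open import Data.Vec.Base using (here; there)
open import Data.Vec.Functional using (_∷_; [])
open import Relation.Binary.PropositionalEquality using (_≡_; cong; trans)
open import Relation.Nullary.Decidable using (Dec; toWitness; T?; _→-dec_; _×-dec_)

pattern one = suc zero
pattern two = suc (suc zero)

∀³? : {n : ℕ} {P : Fin n → Fin n → Fin n → Set} →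
      (∀ a b c → Dec (P a b c)) → Dec (∀ a b c → P a b c)
∀³? P? = all? λ a → all? λ b → all? λ c → P? a b c

pairs : Fin 3 → Subset 3
pairs j = ∁ ⁅ opposite j ⁆

∣pairs∣≡2 : ∀ j → ∣ pairs j ∣ ≡ 2
∣pairs∣≡2 j = trans (∣∁p∣≡n∸∣p∣ ⁅ opposite j ⁆) (cong (3 ∸_) (∣⁅x⁆∣≡1 (opposite j)))

g₀ g₁ g₂ : D → D → D
g₀ zero _    = zero
g₀ one  zero = one
g₀ one  one  = zero
g₀ one  two  = two
g₀ two  b    = b

g₁ zero _    = zero
g₁ one  zero = two
g₁ one  _    = one
g₁ two  _    = one

g₂ zero zero = zero
g₂ zero _    = one
g₂ one  _    = one
g₂ two  _    = two

gadget : (j : Fin 3) → DPow (pairs j) → D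
gadget zero y = g₀ (y (zero , here)) (y (one , there here))
gadget one  y = g₁ (y (zero , here)) (y (two , there (there here)))
gadget two  y = g₂ (y (one , there here)) (y (two , there (there here)))

image : D → D → D → Fin 3 → D
image a b c = g₀ a b ∷ g₁ a c ∷ g₂ b c ∷ []

R₁⇒P₁-image : ∀ a b c → T (R₁ (a ∷ b ∷ c ∷ [])) → T (P₁ (image a b c))
R₁⇒P₁-image = toWitness {a? = ∀³? λ a b c →
  T? (R₁ (a ∷ b ∷ c ∷ [])) →-dec T? (P₁ (image a b c))} tt

S₁∖R₁⇒Q₁∖P₁-image : ∀ a b c → T (S₁ (a ∷ b ∷ c ∷ [])) → T (not (R₁ (a ∷ b ∷ c ∷ []))) →
                    T (Q₁ (image a b c)) × T (not (P₁ (image a b c)))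
S₁∖R₁⇒Q₁∖P₁-image = toWitness {a? = ∀³? λ a b c →
  T? (S₁ (a ∷ b ∷ c ∷ [])) →-dec (T? (not (R₁ (a ∷ b ∷ c ∷ []))) →-dec
    (T? (Q₁ (image a b c)) ×-dec T? (not (P₁ (image a b c)))))} tt

lemmaC4 : Σ (Fin 3 → Subset 3) (λ 𝓘 → ((j : Fin 3) → ∣ 𝓘 j ∣ ≡ 2) × IsSubstructure 𝓘 R₁ S₁ P₁ Q₁)
-- R₁, S₁, P₁, Q₁ and gadget only ever evaluate x at i0, i1, i2, so x may be replaced by
-- x i0 ∷ x i1 ∷ x i2 ∷ [] up to definitional equality.
lemmaC4 = pairs , ∣pairs∣≡2 , gadget
        , (λ x → R₁⇒P₁-image (x i0) (x i1) (x i2))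
        , (λ x → S₁∖R₁⇒Q₁∖P₁-image (x i0) (x i1) (x i2))
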